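{- Let $r$ and $t$ be positive integers with $r\ge 3$ and $2\le t\le \frac{r+3}{3}$, and let $n=3r-t$. If $\rho_2(n,r)\ge 4$, then there exists a 2-packing $S$ of $K(n,r)$ with $|S|=4$ and $i_x(S)\le 2$ for every $x\in[n]$.
   Context: For integers $n\ge 2r\ge 2$, the Kneser graph $K(n,r)$ has as vertices the $r$-element subsets of $[n]=\{1,\dots,n\}$, two vertices being adjacent iff they are disjoint. A 2-packing of a graph is a set of vertices that are pairwise at distance at least $3$ (no two adjacent and no two with a common neighbor); $\rho_2(n,r)$ is the maximum cardinality of a 2-packing of $K(n,r)$. For a set $S$ of vertices of $K(n,r)$ and $x\in[n]$, $i_x(S)=|\{u\in S: x\in u\}|$ is the number of vertices of $S$ containing $x$. -}

module Defs where

open import Data.Nat using (ℕ; _≤_)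
open import Data.Fin using (Fin)
open import Data.Fin.Subset using (Subset; ∣_∣; _∩_; Empty; _∈_)
open import Data.Fin.Subset.Properties using (_∈?_)
open import Data.List using (List; length; filter)
open import Data.List.Membership.Propositional renaming (_∈_ to _∈ₗ_)
open import Data.List.Relation.Unary.All using (All)
open import Data.List.Relation.Unary.Unique.Propositional using (Unique)
open import Data.Product using (Σ; _×_)
open import Relation.Binary.PropositionalEquality using (_≡_; _≢_)
open import Relation.Nullary using (¬_)

IsVertex : (n r : ℕ) → Subset n → Set
IsVertex n r u = ∣ u ∣ ≡ r

Adj : {n : ℕ} → Subset n → Subset n → Set
Adj u v = Empty (u ∩ v)

CommonNeighbour : (n r : ℕ) → Subset n → Subset n → Set
CommonNeighbour n r u v = Σ (Subset n) λ w → IsVertex n r w × Adj u w × Adj v w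

-- A 2-packing of K(n,r): a finite set of vertices (list without repetitions),
-- any two distinct members non-adjacent and without a common neighbour
-- (i.e. at distance at least 3).
Is2Packing : (n r : ℕ) → List (Subset n) → Set
Is2Packing n r S =
  Unique S ×
  All (IsVertex n r) S ×
  (∀ {u v} → u ∈ₗ S → v ∈ₗ S → u ≢ v → ¬ Adj u v × ¬ CommonNeighbour n r u v)

ρ₂≥ : (n r k : ℕ) → Set
ρ₂≥ n r k = Σ (List (Subset n)) λ S → Is2Packing n r S × k ≤ length S

i : {n : ℕ} → Fin n → List (Subset n) → ℕ
i x S = length (filter (x ∈?_) S)

{-# OPTIONS --safe #-}
module Submission where

-- Write t = p + 1 and r = 3p + e, so that n = 3r − t satisfies n + t = 3r.  A common neighbour of
-- two r-sets u, v is an r-subset of the complement of u ∪ v, which has n − 2r + |u ∩ v| points;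
-- hence u and v have one iff |u ∩ v| ≥ t.  In a 2-packing any two members therefore meet in at
-- most p points, and the Bonferroni inequality Σ |uᵢ| ≤ n + Σ_{i<j} |uᵢ ∩ uⱼ| for four members
-- gives 4r ≤ n + 6p, i.e. 6p + 4e ≤ n.  This is exactly the room for the Venn configuration:
-- p points for each of the six pairs of members, e points for each member alone, and the
-- remaining n − 6p − 4e points in none.  Its members have r points, any two share p ∈ [1, t)
-- points, and no point lies in three of them.

open import Defs
open import Data.Bool using (Bool; true; false; if_then_else_; _∧_)
open import Data.Fin using (Fin; #_)
open import Data.Fin.Subset
  using (Subset; ∣_∣; _∩_; _∪_; ∁; ⊥; ⋃; Empty; _⊆_; inside; outside)
open import Data.Fin.Subset.Properties
  using (_∈?_; ∣p∣≤n; ∣∁p∣≡n∸∣p∣; ∣⊥∣≡0; ∉⊥; p⊆q⇒∣p∣≤∣q∣; Empty-unique; ∩-idem; ∩-comm; ∩-zeroʳ;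
         ∩-distribˡ-∪; x∈p∩q⁺; x∈p∩q⁻; x∈p∪q⁺; x∈p∪q⁻; x∈∁p⇒x∉p; x∉p⇒x∈∁p)
open import Data.List using (List; []; _∷_; length; map; take)
open import Data.Nat.ListAction using (sum)
open import Data.Vec using (Vec; []; _∷_; here; there; lookup; replicate; tabulate; toList; _++_)
import Data.Vec as Vec
open import Data.Vec.Properties
  using (map-++; map-replicate; lookup-map; []=⇒lookup; lookup⇒[]=; tabulate-∘; tabulate-cong; tabulate∘lookup)
import Data.Vec.Relation.Unary.All as VecAll
import Data.Vec.Relation.Unary.All.Properties as VecAll
open import Data.List.Properties using (length-take)
open import Data.List.Membership.Propositional using () renaming (_∈_ to _∈ₗ_)
open import Data.List.Relation.Unary.All as All using (All; []; _∷_)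
import Data.List.Relation.Unary.All.Properties as All
open import Data.List.Relation.Unary.AllPairs as AllPairs using (AllPairs; []; _∷_)
import Data.List.Relation.Unary.AllPairs.Properties as AllPairs
open import Data.List.Relation.Unary.Any using (here; there)
open import Data.Nat using (ℕ; zero; suc; _+_; _*_; _∸_; _≤_; _<_; z≤n; s≤s; s≤s⁻¹; >-nonZero)
open import Data.Nat.Combinatorics using (_C_; nC1≡n; nCk+nC[k+1]≡[n+1]C[k+1])
open import Data.Nat.Properties
open import Data.Nat.Tactic.RingSolver using (solve-∀)
open import Data.Product using (Σ; _×_; _,_; proj₁; proj₂)
open import Data.Sum using ([_,_]; inj₁; inj₂)
open import Function using (_⇔_; mk⇔; Equivalence)
open import Function.Construct.Composition using (_⇔-∘_)
open import Relation.Binary using (Symmetric)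
open import Relation.Nullary using (¬_; contradiction; yes; no)
open import Relation.Nullary.Decidable using (toWitness)
open import Relation.Binary.PropositionalEquality
  using (_≡_; _≢_; refl; sym; trans; cong; cong₂; subst; subst₂; module ≡-Reasoning)

private
  variable
    n : ℕ

∣p∪q∣+∣p∩q∣≡∣p∣+∣q∣ : (p q : Subset n) → ∣ p ∪ q ∣ + ∣ p ∩ q ∣ ≡ ∣ p ∣ + ∣ q ∣
∣p∪q∣+∣p∩q∣≡∣p∣+∣q∣ []            []            = refl
∣p∪q∣+∣p∩q∣≡∣p∣+∣q∣ (inside  ∷ p) (inside  ∷ q) =
  cong suc (trans (+-suc _ _) (trans (cong suc (∣p∪q∣+∣p∩q∣≡∣p∣+∣q∣ p q)) (sym (+-suc _ _))))
∣p∪q∣+∣p∩q∣≡∣p∣+∣q∣ (inside  ∷ p) (outside ∷ q) = cong suc (∣p∪q∣+∣p∩q∣≡∣p∣+∣q∣ p q)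
∣p∪q∣+∣p∩q∣≡∣p∣+∣q∣ (outside ∷ p) (inside  ∷ q) =
  trans (cong suc (∣p∪q∣+∣p∩q∣≡∣p∣+∣q∣ p q)) (sym (+-suc _ _))
∣p∪q∣+∣p∩q∣≡∣p∣+∣q∣ (outside ∷ p) (outside ∷ q) = ∣p∪q∣+∣p∩q∣≡∣p∣+∣q∣ p q

∣p∪q∣≤∣p∣+∣q∣ : (p q : Subset n) → ∣ p ∪ q ∣ ≤ ∣ p ∣ + ∣ q ∣
∣p∪q∣≤∣p∣+∣q∣ p q = ≤-trans (m≤m+n _ _) (≤-reflexive (∣p∪q∣+∣p∩q∣≡∣p∣+∣q∣ p q))

∣p∣+∣∁p∣≡n : (p : Subset n) → ∣ p ∣ + ∣ ∁ p ∣ ≡ n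
∣p∣+∣∁p∣≡n p = trans (cong (∣ p ∣ +_) (∣∁p∣≡n∸∣p∣ p)) (m+[n∸m]≡n (∣p∣≤n p))

∣∁[p∪q]∣+∣p∣+∣q∣≡n+∣p∩q∣ : (p q : Subset n) → ∣ ∁ (p ∪ q) ∣ + (∣ p ∣ + ∣ q ∣) ≡ n + ∣ p ∩ q ∣
∣∁[p∪q]∣+∣p∣+∣q∣≡n+∣p∩q∣ {n} p q = begin
  ∣ ∁ (p ∪ q) ∣ + (∣ p ∣ + ∣ q ∣)          ≡⟨ cong (∣ ∁ (p ∪ q) ∣ +_) (∣p∪q∣+∣p∩q∣≡∣p∣+∣q∣ p q) ⟨
  ∣ ∁ (p ∪ q) ∣ + (∣ p ∪ q ∣ + ∣ p ∩ q ∣)  ≡⟨ +-assoc ∣ ∁ (p ∪ q) ∣ _ _ ⟨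
  (∣ ∁ (p ∪ q) ∣ + ∣ p ∪ q ∣) + ∣ p ∩ q ∣  ≡⟨ cong (_+ ∣ p ∩ q ∣) (+-comm ∣ ∁ (p ∪ q) ∣ ∣ p ∪ q ∣) ⟩
  (∣ p ∪ q ∣ + ∣ ∁ (p ∪ q) ∣) + ∣ p ∩ q ∣  ≡⟨ cong (_+ ∣ p ∩ q ∣) (∣p∣+∣∁p∣≡n (p ∪ q)) ⟩
  n + ∣ p ∩ q ∣                            ∎
  where open ≡-Reasoning

∣p∩q∣<∣p∣⇒p≢q : (p q : Subset n) → ∣ p ∩ q ∣ < ∣ p ∣ → p ≢ q
∣p∩q∣<∣p∣⇒p≢q p _ lt refl = <-irrefl (cong ∣_∣ (∩-idem p)) lt

0<∣p∩q∣⇒¬Empty : (p q : Subset n) → 0 < ∣ p ∩ q ∣ → ¬ Empty (p ∩ q)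
0<∣p∩q∣⇒¬Empty {n} p q 0<∣p∩q∣ empty =
  <-irrefl (sym (trans (cong ∣_∣ (Empty-unique empty)) (∣⊥∣≡0 n))) 0<∣p∩q∣

subsetOfSize : (p : Subset n) {k : ℕ} → k ≤ ∣ p ∣ → Σ (Subset n) λ q → q ⊆ p × ∣ q ∣ ≡ k
subsetOfSize {n} p {zero} _ = ⊥ , (λ x∈⊥ → contradiction x∈⊥ ∉⊥) , ∣⊥∣≡0 n
subsetOfSize (inside ∷ p) {suc k} k<∣p∣ with subsetOfSize p (s≤s⁻¹ k<∣p∣)
... | q , q⊆p , ∣q∣≡k = inside ∷ q , (λ { here → here ; (there x∈q) → there (q⊆p x∈q) }) , cong suc ∣q∣≡k
subsetOfSize (outside ∷ p) {suc k} k<∣p∣ with subsetOfSize p k<∣p∣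
... | q , q⊆p , ∣q∣≡k = outside ∷ q , (λ { (there x∈q) → there (q⊆p x∈q) }) , ∣q∣≡k

∣p++q∣≡∣p∣+∣q∣ : ∀ {m} (p : Subset m) (q : Subset n) → ∣ p ++ q ∣ ≡ ∣ p ∣ + ∣ q ∣
∣p++q∣≡∣p∣+∣q∣ []            q = refl
∣p++q∣≡∣p∣+∣q∣ (inside  ∷ p) q = cong suc (∣p++q∣≡∣p∣+∣q∣ p q)
∣p++q∣≡∣p∣+∣q∣ (outside ∷ p) q = ∣p++q∣≡∣p∣+∣q∣ p q

∣replicate∣ : ∀ k b → ∣ replicate k b ∣ ≡ (if b then k else 0)
∣replicate∣ zero    true  = refl
∣replicate∣ zero    false = refl
∣replicate∣ (suc k) true  = cong suc (∣replicate∣ k true)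
∣replicate∣ (suc k) false = ∣replicate∣ k false

map-∩ : ∀ {A : Set} (f g : A → Bool) (xs : Vec A n) →
        Vec.map f xs ∩ Vec.map g xs ≡ Vec.map (λ x → f x ∧ g x) xs
map-∩ f g []       = refl
map-∩ f g (x ∷ xs) = cong (f x ∧ g x ∷_) (map-∩ f g xs)

i≡∣map-lookup∣ : ∀ {m} (x : Fin n) (us : Vec (Subset n) m) → i x (toList us) ≡ ∣ Vec.map (λ u → lookup u x) us ∣
i≡∣map-lookup∣ x []       = refl
i≡∣map-lookup∣ x (u ∷ us) with lookup u x in ux≡b | x ∈? u
... | true  | yes _   = cong suc (i≡∣map-lookup∣ x us)
... | true  | no x∉u  = contradiction (lookup⇒[]= x u ux≡b) x∉u
... | false | yes x∈u = contradiction (trans (sym ([]=⇒lookup x∈u)) ux≡b) λ ()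
... | false | no _    = i≡∣map-lookup∣ x us

∣p∩⋃S∣≤sum : (p : Subset n) (S : List (Subset n)) → ∣ p ∩ ⋃ S ∣ ≤ sum (map (λ q → ∣ p ∩ q ∣) S)
∣p∩⋃S∣≤sum {n} p [] = ≤-reflexive (trans (cong ∣_∣ (∩-zeroʳ p)) (∣⊥∣≡0 n))
∣p∩⋃S∣≤sum p (q ∷ S) = begin
  ∣ p ∩ (q ∪ ⋃ S) ∣           ≡⟨ cong ∣_∣ (∩-distribˡ-∪ p q (⋃ S)) ⟩
  ∣ (p ∩ q) ∪ (p ∩ ⋃ S) ∣     ≤⟨ ∣p∪q∣≤∣p∣+∣q∣ (p ∩ q) (p ∩ ⋃ S) ⟩
  ∣ p ∩ q ∣ + ∣ p ∩ ⋃ S ∣     ≤⟨ +-monoʳ-≤ ∣ p ∩ q ∣ (∣p∩⋃S∣≤sum p S) ⟩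
  ∣ p ∩ q ∣ + sum (map (λ q → ∣ p ∩ q ∣) S) ∎
  where open ≤-Reasoning

overlapSum : List (Subset n) → ℕ
overlapSum []      = 0
overlapSum (p ∷ S) = sum (map (λ q → ∣ p ∩ q ∣) S) + overlapSum S

sum∣S∣≤∣⋃S∣+overlapSum : (S : List (Subset n)) → sum (map ∣_∣ S) ≤ ∣ ⋃ S ∣ + overlapSum S
sum∣S∣≤∣⋃S∣+overlapSum []      = z≤n
sum∣S∣≤∣⋃S∣+overlapSum (p ∷ S) = begin
  ∣ p ∣ + sum (map ∣_∣ S)
    ≤⟨ +-monoʳ-≤ ∣ p ∣ (sum∣S∣≤∣⋃S∣+overlapSum S) ⟩
  ∣ p ∣ + (∣ ⋃ S ∣ + overlapSum S)
    ≡⟨ +-assoc ∣ p ∣ _ _ ⟨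
  (∣ p ∣ + ∣ ⋃ S ∣) + overlapSum S
    ≡⟨ cong (_+ overlapSum S) (∣p∪q∣+∣p∩q∣≡∣p∣+∣q∣ p (⋃ S)) ⟨
  (∣ p ∪ ⋃ S ∣ + ∣ p ∩ ⋃ S ∣) + overlapSum S
    ≤⟨ +-monoˡ-≤ (overlapSum S) (+-monoʳ-≤ ∣ p ∪ ⋃ S ∣ (∣p∩⋃S∣≤sum p S)) ⟩
  (∣ p ∪ ⋃ S ∣ + sum (map (λ q → ∣ p ∩ q ∣) S)) + overlapSum S
    ≡⟨ +-assoc ∣ p ∪ ⋃ S ∣ _ _ ⟩
  ∣ p ∪ ⋃ S ∣ + overlapSum (p ∷ S)
    ∎
  where open ≤-Reasoning

module _ {A : Set} (f : A → ℕ) {c : ℕ} where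

  sum-map-≡ : {xs : List A} → All (λ x → f x ≡ c) xs → sum (map f xs) ≡ length xs * c
  sum-map-≡ []             = refl
  sum-map-≡ (fx≡c ∷ fxs≡c) = cong₂ _+_ fx≡c (sum-map-≡ fxs≡c)

  sum-map-≤ : {xs : List A} → All (λ x → f x ≤ c) xs → sum (map f xs) ≤ length xs * c
  sum-map-≤ []             = z≤n
  sum-map-≤ (fx≤c ∷ fxs≤c) = +-mono-≤ fx≤c (sum-map-≤ fxs≤c)

[1+m]C2≡m+mC2 : ∀ m → suc m C 2 ≡ m + m C 2
[1+m]C2≡m+mC2 m = trans (sym (nCk+nC[k+1]≡[n+1]C[k+1] m 1)) (cong (_+ m C 2) (nC1≡n m))

overlapSum≤ : {S : List (Subset n)} {c : ℕ} →
              AllPairs (λ p q → ∣ p ∩ q ∣ ≤ c) S → overlapSum S ≤ (length S C 2) * c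
overlapSum≤ []                              = z≤n
overlapSum≤ {S = p ∷ S} {c} (p∩S≤c ∷ S∩S≤c) = begin
  sum (map (λ q → ∣ p ∩ q ∣) S) + overlapSum S
    ≤⟨ +-mono-≤ (sum-map-≤ (λ q → ∣ p ∩ q ∣) p∩S≤c) (overlapSum≤ S∩S≤c) ⟩
  length S * c + (length S C 2) * c
    ≡⟨ *-distribʳ-+ c (length S) _ ⟨
  (length S + length S C 2) * c
    ≡⟨ cong (_* c) ([1+m]C2≡m+mC2 (length S)) ⟨
  (suc (length S) C 2) * c
    ∎
  where open ≤-Reasoning

uniformBonferroni : {S : List (Subset n)} {r c : ℕ} →
  All (λ p → ∣ p ∣ ≡ r) S → AllPairs (λ p q → ∣ p ∩ q ∣ ≤ c) S →
  length S * r ≤ n + (length S C 2) * c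
uniformBonferroni {n} {S} {r} ∣S∣≡r S∩S≤c = begin
  length S * r           ≡⟨ sum-map-≡ ∣_∣ ∣S∣≡r ⟨
  sum (map ∣_∣ S)        ≤⟨ sum∣S∣≤∣⋃S∣+overlapSum S ⟩
  ∣ ⋃ S ∣ + overlapSum S ≤⟨ +-mono-≤ (∣p∣≤n (⋃ S)) (overlapSum≤ S∩S≤c) ⟩
  n + (length S C 2) * _ ∎
  where open ≤-Reasoning

module _ {u v w : Subset n} where

  adjacentToBoth⇒⊆∁∪ : Adj u w → Adj v w → w ⊆ ∁ (u ∪ v)
  adjacentToBoth⇒⊆∁∪ u∩w=∅ v∩w=∅ {x} x∈w = x∉p⇒x∈∁p λ x∈u∪v →
    [ (λ x∈u → u∩w=∅ (x , x∈p∩q⁺ (x∈u , x∈w))) , (λ x∈v → v∩w=∅ (x , x∈p∩q⁺ (x∈v , x∈w))) ]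
      (x∈p∪q⁻ u v x∈u∪v)

  ⊆∁∪⇒adjacentToBoth : w ⊆ ∁ (u ∪ v) → Adj u w × Adj v w
  ⊆∁∪⇒adjacentToBoth w⊆ =
    (λ (x , x∈u∩w) → let x∈u , x∈w = x∈p∩q⁻ u w x∈u∩w in x∈∁p⇒x∉p (w⊆ x∈w) (x∈p∪q⁺ (inj₁ x∈u))) ,
    (λ (x , x∈v∩w) → let x∈v , x∈w = x∈p∩q⁻ v w x∈v∩w in x∈∁p⇒x∉p (w⊆ x∈w) (x∈p∪q⁺ (inj₂ x∈v)))

commonNeighbour⇔r≤∣∁[u∪v]∣ : ∀ {r} (u v : Subset n) → CommonNeighbour n r u v ⇔ r ≤ ∣ ∁ (u ∪ v) ∣
commonNeighbour⇔r≤∣∁[u∪v]∣ u v = mk⇔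
  (λ (w , ∣w∣≡r , u∩w=∅ , v∩w=∅) →
     subst (_≤ _) ∣w∣≡r (p⊆q⇒∣p∣≤∣q∣ (adjacentToBoth⇒⊆∁∪ u∩w=∅ v∩w=∅)))
  (λ r≤∣∁[u∪v]∣ → let w , w⊆ , ∣w∣≡r = subsetOfSize (∁ (u ∪ v)) r≤∣∁[u∪v]∣ in
     w , ∣w∣≡r , ⊆∁∪⇒adjacentToBoth w⊆)

r≤c⇔t≤x : ∀ {t r c x} → n + t ≡ 3 * r → c + 2 * r ≡ n + x → r ≤ c ⇔ t ≤ x
r≤c⇔t≤x {n} {t} {r} {c} {x} n+t≡3r c+2r≡n+x = mk⇔
  (λ r≤c → +-cancelˡ-≤ n t x (begin
     n + t     ≡⟨ n+t≡3r ⟩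
     r + 2 * r ≤⟨ +-monoˡ-≤ (2 * r) r≤c ⟩
     c + 2 * r ≡⟨ c+2r≡n+x ⟩
     n + x     ∎))
  (λ t≤x → +-cancelʳ-≤ (2 * r) r c (begin
     r + 2 * r ≡⟨ n+t≡3r ⟨
     n + t     ≤⟨ +-monoʳ-≤ n t≤x ⟩
     n + x     ≡⟨ c+2r≡n+x ⟨
     c + 2 * r ∎))
  where open ≤-Reasoning

commonNeighbour⇔t≤∣u∩v∣ : ∀ {t r} {u v : Subset n} → n + t ≡ 3 * r → ∣ u ∣ ≡ r → ∣ v ∣ ≡ r →
                          CommonNeighbour n r u v ⇔ t ≤ ∣ u ∩ v ∣
commonNeighbour⇔t≤∣u∩v∣ {n} {t} {r} {u} {v} n+t≡3r ∣u∣≡r ∣v∣≡r =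
  r≤c⇔t≤x n+t≡3r c+2r≡n+x ⇔-∘ commonNeighbour⇔r≤∣∁[u∪v]∣ u v
  where
  c+2r≡n+x : ∣ ∁ (u ∪ v) ∣ + 2 * r ≡ n + ∣ u ∩ v ∣
  c+2r≡n+x = trans (cong (∣ ∁ (u ∪ v) ∣ +_) (cong₂ _+_ (sym ∣u∣≡r) (trans (+-identityʳ r) (sym ∣v∣≡r))))
                   (∣∁[p∪q]∣+∣p∣+∣q∣≡n+∣p∩q∣ u v)

module _ {A : Set} {R : A → A → Set} where

  AllPairs⇒distinctMembers : Symmetric R → {S : List A} → AllPairs R S →
                             ∀ {x y} → x ∈ₗ S → y ∈ₗ S → x ≢ y → R x y
  AllPairs⇒distinctMembers _     _        (here refl) (here refl) x≢y = contradiction refl x≢y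
  AllPairs⇒distinctMembers _     (Rx ∷ _) (here refl) (there y∈S) _   = All.lookup Rx y∈S
  AllPairs⇒distinctMembers R-sym (Ry ∷ _) (there x∈S) (here refl) _   = R-sym (All.lookup Ry x∈S)
  AllPairs⇒distinctMembers R-sym (_ ∷ RS) (there x∈S) (there y∈S) x≢y =
    AllPairs⇒distinctMembers R-sym RS x∈S y∈S x≢y

  distinctMembers⇒AllPairs : {S : List A} → AllPairs _≢_ S →
                             (∀ {x y} → x ∈ₗ S → y ∈ₗ S → x ≢ y → R x y) → AllPairs R S
  distinctMembers⇒AllPairs []              _ = []
  distinctMembers⇒AllPairs (x≢S ∷ unique) R-distinct =
    All.tabulate (λ y∈S → R-distinct (here refl) (there y∈S) (All.lookup x≢S y∈S)) ∷
    distinctMembers⇒AllPairs unique (λ x∈S y∈S → R-distinct (there x∈S) (there y∈S))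

2Packing⇒∣u∩v∣<t : ∀ {t r} {S : List (Subset n)} → n + t ≡ 3 * r → Is2Packing n r S →
                   AllPairs (λ u v → ∣ u ∩ v ∣ < t) S
2Packing⇒∣u∩v∣<t n+t≡3r (unique , vertices , separated) =
  distinctMembers⇒AllPairs unique λ u∈S v∈S u≢v → ≰⇒> λ t≤∣u∩v∣ →
    proj₂ (separated u∈S v∈S u≢v)
      (Equivalence.from (commonNeighbour⇔t≤∣u∩v∣ n+t≡3r (All.lookup vertices u∈S) (All.lookup vertices v∈S))
        t≤∣u∩v∣)

Intersecting : ℕ → Subset n → Subset n → Set
Intersecting t u v = 0 < ∣ u ∩ v ∣ × ∣ u ∩ v ∣ < t

intersecting⇒2Packing : ∀ {t r} {S : List (Subset n)} → n + t ≡ 3 * r → t ≤ r →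
                        All (IsVertex n r) S → AllPairs (Intersecting t) S → Is2Packing n r S
intersecting⇒2Packing {n} {t} {r} {S} n+t≡3r t≤r vertices intersecting =
  distinct vertices intersecting , vertices , separated
  where
  distinct : ∀ {S} → All (IsVertex n r) S → AllPairs (Intersecting t) S → AllPairs _≢_ S
  distinct []                    []                  = []
  distinct {u ∷ _} (∣u∣≡r ∷ sizes) (u-meets-S ∷ pairs) =
    All.map (λ {v} (_ , ∣u∩v∣<t) → ∣p∩q∣<∣p∣⇒p≢q u v (<-≤-trans ∣u∩v∣<t (≤-trans t≤r (≤-reflexive (sym ∣u∣≡r)))))
      u-meets-S ∷ distinct sizes pairs
  symmetric : ∀ {u v} → Intersecting t u v → Intersecting t v u
  symmetric {u} {v} = subst (λ w → 0 < ∣ w ∣ × ∣ w ∣ < t) (∩-comm u v)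
  separated : ∀ {u v} → u ∈ₗ S → v ∈ₗ S → u ≢ v → ¬ Adj u v × ¬ CommonNeighbour n r u v
  separated {u} {v} u∈S v∈S u≢v
    with AllPairs⇒distinctMembers {R = Intersecting t} (λ {x} {y} → symmetric {x} {y}) intersecting u∈S v∈S u≢v
  ... | 0<∣u∩v∣ , ∣u∩v∣<t =
    0<∣p∩q∣⇒¬Empty u v 0<∣u∩v∣ ,
    λ common → <⇒≱ ∣u∩v∣<t
      (Equivalence.to (commonNeighbour⇔t≤∣u∩v∣ n+t≡3r (All.lookup vertices u∈S) (All.lookup vertices v∈S)) common)

ρ₂≥⇒k*r≤n+kC2*c : ∀ {c r k} → n + suc c ≡ 3 * r → ρ₂≥ n r k → k * r ≤ n + (k C 2) * c
ρ₂≥⇒k*r≤n+kC2*c {n} {c} {r} {k} n+t≡3r (S , packing@(_ , vertices , _) , k≤∣S∣) =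
  subst (λ m → m * r ≤ n + (m C 2) * c) ∣take∣≡k
    (uniformBonferroni (All.take⁺ k vertices)
      (AllPairs.take⁺ k (AllPairs.map s≤s⁻¹ (2Packing⇒∣u∩v∣<t n+t≡3r packing))))
  where
  ∣take∣≡k : length (take k S) ≡ k
  ∣take∣≡k = trans (length-take k S) (m≤n⇒m⊓n≡m k≤∣S∣)

-- A block (R , k) stands for k points whose incidence row is R.
Blocks : ℕ → Set
Blocks m = List (Subset m × ℕ)

module _ {m : ℕ} where

  points : Blocks m → ℕ
  points bs = sum (map proj₂ bs)

  expand : (bs : Blocks m) → Vec (Subset m) (points bs)
  expand []             = []
  expand ((R , k) ∷ bs) = replicate k R ++ expand bs

  pointsWhere : (Subset m → Bool) → Subset m × ℕ → ℕ
  pointsWhere f (R , k) = if f R then k else 0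

  ∣map-expand∣ : (f : Subset m → Bool) (bs : Blocks m) →
                 ∣ Vec.map f (expand bs) ∣ ≡ sum (map (pointsWhere f) bs)
  ∣map-expand∣ f []             = refl
  ∣map-expand∣ f ((R , k) ∷ bs) = begin
    ∣ Vec.map f (replicate k R ++ expand bs) ∣                ≡⟨ cong ∣_∣ (map-++ f (replicate k R) (expand bs)) ⟩
    ∣ Vec.map f (replicate k R) ++ Vec.map f (expand bs) ∣    ≡⟨ ∣p++q∣≡∣p∣+∣q∣ (Vec.map f (replicate k R)) _ ⟩
    ∣ Vec.map f (replicate k R) ∣ + ∣ Vec.map f (expand bs) ∣ ≡⟨ cong (_+ _) (cong ∣_∣ (map-replicate f R k)) ⟩
    ∣ replicate k (f R) ∣ + ∣ Vec.map f (expand bs) ∣         ≡⟨ cong₂ _+_ (∣replicate∣ k (f R)) (∣map-expand∣ f bs) ⟩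
    pointsWhere f (R , k) + sum (map (pointsWhere f) bs)      ∎
    where open ≡-Reasoning

  All-expand : ∀ {P : Subset m → Set} (bs : Blocks m) →
               All (λ b → P (proj₁ b)) bs → VecAll.All P (expand bs)
  All-expand []             []         = VecAll.[]
  All-expand ((R , k) ∷ bs) (PR ∷ Pbs) = VecAll.++⁺ (replicate⁺ k) (All-expand bs Pbs)
    where
    replicate⁺ : ∀ k → VecAll.All _ (replicate k R)
    replicate⁺ zero    = VecAll.[]
    replicate⁺ (suc k) = PR VecAll.∷ replicate⁺ k

-- A family of m subsets of [n] is given by its n incidence rows: row x lists the members containing x.
column : ∀ {m} → Vec (Subset m) n → Fin m → Subset n
column rows k = Vec.map (λ R → lookup R k) rows

columns : ∀ {m} → Vec (Subset m) n → Vec (Subset n) m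
columns rows = tabulate (column rows)

i-columns : ∀ {m} (rows : Vec (Subset m) n) (x : Fin n) → i x (toList (columns rows)) ≡ ∣ lookup rows x ∣
i-columns rows x = trans (i≡∣map-lookup∣ x (columns rows)) (cong ∣_∣ (begin
  Vec.map (λ u → lookup u x) (tabulate (column rows))  ≡⟨ tabulate-∘ (λ u → lookup u x) (column rows) ⟨
  tabulate (λ k → lookup (column rows k) x)             ≡⟨ tabulate-cong (λ k → lookup-map x (λ R → lookup R k) rows) ⟩
  tabulate (lookup (lookup rows x))                     ≡⟨ tabulate∘lookup (lookup rows x) ⟩
  lookup rows x                                         ∎))
  where open ≡-Reasoning

module _ {m : ℕ} (bs : Blocks m) where

  ∣column-expand∣ : ∀ k → ∣ column (expand bs) k ∣ ≡ sum (map (pointsWhere (λ R → lookup R k)) bs)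
  ∣column-expand∣ k = ∣map-expand∣ (λ R → lookup R k) bs

  ∣column-expand∩column-expand∣ : ∀ k l → ∣ column (expand bs) k ∩ column (expand bs) l ∣ ≡
                                          sum (map (pointsWhere (λ R → lookup R k ∧ lookup R l)) bs)
  ∣column-expand∩column-expand∣ k l =
    trans (cong ∣_∣ (map-∩ (λ R → lookup R k) (λ R → lookup R l) (expand bs)))
          (∣map-expand∣ (λ R → lookup R k ∧ lookup R l) bs)

  i-columns-expand≤ : ∀ {c} → All (λ b → ∣ proj₁ b ∣ ≤ c) bs → (x : Fin (points bs)) →
                      i x (toList (columns (expand bs))) ≤ c
  i-columns-expand≤ {c} rows≤c x =
    subst (_≤ c) (sym (i-columns (expand bs) x)) (VecAll.lookup⁺ (All-expand bs rows≤c) x)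

SparsePacking₄ : ℕ → ℕ → Set
SparsePacking₄ n r =
  Σ (List (Subset n)) λ S → Is2Packing n r S × length S ≡ 4 × ((x : Fin n) → i x S ≤ 2)

venn : ℕ → ℕ → ℕ → Blocks 4
venn p e z =
  (inside  ∷ inside  ∷ outside ∷ outside ∷ [] , p) ∷
  (inside  ∷ outside ∷ inside  ∷ outside ∷ [] , p) ∷
  (inside  ∷ outside ∷ outside ∷ inside  ∷ [] , p) ∷
  (outside ∷ inside  ∷ inside  ∷ outside ∷ [] , p) ∷
  (outside ∷ inside  ∷ outside ∷ inside  ∷ [] , p) ∷
  (outside ∷ outside ∷ inside  ∷ inside  ∷ [] , p) ∷
  (inside  ∷ outside ∷ outside ∷ outside ∷ [] , e) ∷
  (outside ∷ inside  ∷ outside ∷ outside ∷ [] , e) ∷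
  (outside ∷ outside ∷ inside  ∷ outside ∷ [] , e) ∷
  (outside ∷ outside ∷ outside ∷ inside  ∷ [] , e) ∷
  (outside ∷ outside ∷ outside ∷ outside ∷ [] , z) ∷ []

points-venn : ∀ p e z → points (venn p e z) ≡ 6 * p + 4 * e + z
points-venn = sixPairBlocks+fourOwnBlocks+z
  where
  sixPairBlocks+fourOwnBlocks+z : ∀ p e z →
    p + (p + (p + (p + (p + (p + (e + (e + (e + (e + (z + 0)))))))))) ≡ 6 * p + 4 * e + z
  sixPairBlocks+fourOwnBlocks+z = solve-∀

threePairBlocks+ownBlock : ∀ p e → p + (p + (p + (e + 0))) ≡ 3 * p + e
threePairBlocks+ownBlock = solve-∀

vennPacking : ∀ p e z → 0 < p → points (venn p e z) + suc p ≡ 3 * (3 * p + e) →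
              SparsePacking₄ (points (venn p e z)) (3 * p + e)
vennPacking p e z 0<p n+t≡3r =
  toList (columns rows) ,
  intersecting⇒2Packing n+t≡3r t≤r
    (vertex (# 0) refl ∷ vertex (# 1) refl ∷ vertex (# 2) refl ∷ vertex (# 3) refl ∷ [])
    ((meet (# 0) (# 1) refl ∷ meet (# 0) (# 2) refl ∷ meet (# 0) (# 3) refl ∷ []) ∷
     (meet (# 1) (# 2) refl ∷ meet (# 1) (# 3) refl ∷ []) ∷
     (meet (# 2) (# 3) refl ∷ []) ∷ [] ∷ []) ,
  refl ,
  i-columns-expand≤ (venn p e z) (toWitness {a? = All.all? (λ b → ∣ proj₁ b ∣ ≤? 2) (venn p e z)} _)
  where
  rows : Vec (Subset 4) (points (venn p e z))
  rows = expand (venn p e z)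
  t≤r : suc p ≤ 3 * p + e
  t≤r = ≤-trans (≤-trans (m<m*n p 3 {{>-nonZero 0<p}} (s≤s (s≤s z≤n))) (≤-reflexive (*-comm p 3)))
                (m≤m+n (3 * p) e)
  -- For concrete k and l the block sums reduce, which is why vertex and meet are applied to refl.
  vertex : ∀ k → sum (map (pointsWhere (λ R → lookup R k)) (venn p e z)) ≡ p + (p + (p + (e + 0))) →
           IsVertex _ (3 * p + e) (column rows k)
  vertex k sum≡ = trans (∣column-expand∣ (venn p e z) k) (trans sum≡ (threePairBlocks+ownBlock p e))
  meet : ∀ k l → sum (map (pointsWhere (λ R → lookup R k ∧ lookup R l)) (venn p e z)) ≡ p + 0 →
         Intersecting (suc p) (column rows k) (column rows l)
  meet k l sum≡ = subst (λ s → 0 < s × s < suc p) (sym ∣u∩v∣≡p) (0<p , ≤-refl)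
    where
    ∣u∩v∣≡p : ∣ column rows k ∩ column rows l ∣ ≡ p
    ∣u∩v∣≡p = trans (∣column-expand∩column-expand∣ (venn p e z) k l) (trans sum≡ (+-identityʳ p))

4[3p+e]≡6p+4e+6p : ∀ p e → 4 * (3 * p + e) ≡ (6 * p + 4 * e) + 6 * p
4[3p+e]≡6p+4e+6p = solve-∀

ρ₂≥4⇒sparsePacking₄ : ∀ {n} p e → 0 < p → n + suc p ≡ 3 * (3 * p + e) → ρ₂≥ n (3 * p + e) 4 →
                      SparsePacking₄ n (3 * p + e)
ρ₂≥4⇒sparsePacking₄ {n} p e 0<p n+t≡3r ρ₂≥4 with m≤n⇒∃[o]m+o≡n 6p+4e≤n
  where
  6p+4e≤n : 6 * p + 4 * e ≤ n
  6p+4e≤n = +-cancelʳ-≤ (6 * p) _ _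
    (subst (_≤ n + 6 * p) (4[3p+e]≡6p+4e+6p p e) (ρ₂≥⇒k*r≤n+kC2*c n+t≡3r ρ₂≥4))
... | z , refl = subst (λ m → SparsePacking₄ m (3 * p + e)) (points-venn p e z)
                   (vennPacking p e z 0<p (trans (cong (_+ suc p) (points-venn p e z)) n+t≡3r))

3[1+p]≤r+3⇒3p≤r : ∀ {p r} → 3 * suc p ≤ r + 3 → 3 * p ≤ r
3[1+p]≤r+3⇒3p≤r {p} {r} le = +-cancelˡ-≤ 3 (3 * p) r (subst₂ _≤_ (*-suc 3 p) (+-comm r 3) le)

3t≤r+3⇒t≤3r : ∀ {t r} → 3 ≤ r → 3 * t ≤ r + 3 → t ≤ 3 * r
3t≤r+3⇒t≤3r {t} {r} 3≤r 3t≤r+3 = begin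
  t          ≤⟨ m≤n*m t 3 ⟩
  3 * t      ≤⟨ 3t≤r+3 ⟩
  r + 3      ≤⟨ +-monoʳ-≤ r (≤-trans 3≤r (m≤m+n r (r + 0))) ⟩
  3 * r      ∎
  where open ≤-Reasoning

mainTheorem12 : (r t : ℕ) → 3 ≤ r → 2 ≤ t → 3 * t ≤ r + 3 →
    ρ₂≥ (3 * r ∸ t) r 4 →
    Σ (List (Subset (3 * r ∸ t))) λ S →
      Is2Packing (3 * r ∸ t) r S × length S ≡ 4 ×
      ((x : Fin (3 * r ∸ t)) → i x S ≤ 2)
mainTheorem12 r (suc p) 3≤r (s≤s 0<p) 3t≤r+3 with m≤n⇒∃[o]m+o≡n (3[1+p]≤r+3⇒3p≤r 3t≤r+3)
... | e , refl = ρ₂≥4⇒sparsePacking₄ p e 0<p (m∸n+n≡m (3t≤r+3⇒t≤3r {suc p} 3≤r 3t≤r+3))
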